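{- For every finite group $G$ of order $|G|=q\geq2$, there is a monomial degeneration of $T_G$ into a tensor which (after renaming variables) is a generalized Coppersmith–Winograd tensor $CW^\sigma_{q-2}$ with parameter $q-2$ for some permutation $\sigma$ of $\{1,\dots,q-2\}$.
   Context: For a finite group $G$ (multiplicative), $T_G=\sum_{g,h\in G}x_gy_hz_{gh}$ over $\{x_g\},\{y_g\},\{z_g\}$. A tensor $t$ is a monomial degeneration of $t'$ if $t$ is obtained from $t'$ by deleting some terms and there are functions $a,b,c$ from the $x$-, $y$-, $z$-variables to $\mathbb{Z}$ such that every term $x_iy_jz_k$ of $t'$ has $a(x_i)+b(y_j)+c(z_k)\ge0$, every term of $t'$ with sum $0$ is kept in $t$ with the same coefficient, and every term of $t$ has sum $0$. For a nonnegative integer $m$ and permutation $\sigma$ of $\{1,\dots,m\}$, $CW^\sigma_m=x_0y_0z_{m+1}+x_0y_{m+1}z_0+x_{m+1}y_0z_0+\sum_{i=1}^m(x_iy_{\sigma(i)}z_0+x_iy_0z_i+x_0y_iz_i)$. -}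

module Defs where

open import Data.Nat using (ℕ; zero; suc; _+_; _*_)
open import Data.Integer as ℤ using (ℤ)
open import Data.Fin using (Fin; zero; suc; inject₁; fromℕ)
import Data.Fin as Fin
open import Data.Fin.Permutation using (Permutation′; _⟨$⟩ʳ_)
open import Data.Bool using (if_then_else_)
open import Data.Sum using (_⊎_)
open import Relation.Nullary using (¬_)
open import Relation.Nullary.Decidable using (⌊_⌋)
open import Relation.Binary.Definitions using (DecidableEquality)
open import Relation.Binary.PropositionalEquality using (_≡_)
open import Algebra.Structures using (IsGroup)
open import Function.Bundles using (_⤖_)

record FiniteGroup : Set₁ where
  field
    Carrier  : Set
    _∙_      : Carrier → Carrier → Carrier
    ε        : Carrier
    _⁻¹      : Carrier → Carrier
    isGroup  : IsGroup _≡_ _∙_ ε _⁻¹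
    _≟_      : DecidableEquality Carrier
    order    : ℕ
    enum     : Fin order ⤖ Carrier

-- A trilinear tensor over variable sets X, Y, Z (coefficients in ℕ):
-- t i j k is the coefficient of the monomial x_i y_j z_k.
Tensor : Set → Set → Set → Set
Tensor X Y Z = X → Y → Z → ℕ

δ : {A : Set} → DecidableEquality A → A → A → ℕ
δ _≟_ a b = if ⌊ a ≟ b ⌋ then 1 else 0

-- T_G = Σ_{g,h} x_g y_h z_{gh}: coefficient of x_i y_j z_k is [k = i j].
T : (G : FiniteGroup) → let open FiniteGroup G in Tensor Carrier Carrier Carrier
T G i j k = δ _≟_ k (i ∙ j)
  where open FiniteGroup G

record MonomialDegeneration {X Y Z : Set} (t′ t : Tensor X Y Z) : Set where
  field
    a : X → ℤ
    b : Y → ℤ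
    c : Z → ℤ
    deletion : ∀ i j k → t i j k ≡ 0 ⊎ t i j k ≡ t′ i j k
    nonneg   : ∀ i j k → ¬ (t′ i j k ≡ 0) → ℤ.0ℤ ℤ.≤ (a i ℤ.+ b j ℤ.+ c k)
    keep     : ∀ i j k → ¬ (t′ i j k ≡ 0) → (a i ℤ.+ b j ℤ.+ c k) ≡ ℤ.0ℤ
               → t i j k ≡ t′ i j k
    weight0  : ∀ i j k → ¬ (t i j k ≡ 0) → (a i ℤ.+ b j ℤ.+ c k) ≡ ℤ.0ℤ

ΣFin : (n : ℕ) → (Fin n → ℕ) → ℕ
ΣFin zero    f = 0
ΣFin (suc n) f = f zero + ΣFin n (λ l → f (suc l))

-- Variables of CW^σ_m are indexed 0,…,m+1 by Fin (m+2);
-- index i ∈ {1,…,m} corresponds to l ∈ Fin m via i = l+1.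
inner : {m : ℕ} → Fin m → Fin (suc (suc m))
inner l = suc (inject₁ l)

top : {m : ℕ} → Fin (suc (suc m))
top {m} = fromℕ (suc m)

δF : {n : ℕ} → Fin n → Fin n → ℕ
δF = δ Fin._≟_

CW : (m : ℕ) → Permutation′ m → Tensor (Fin (suc (suc m))) (Fin (suc (suc m))) (Fin (suc (suc m)))
CW m σ i j k =
    δF i zero * δF j zero * δF k top
  + δF i zero * δF j top  * δF k zero
  + δF i top  * δF j zero * δF k zero
  + ΣFin m (λ l →
        δF i (inner l) * δF j (inner (σ ⟨$⟩ʳ l)) * δF k zero
      + δF i (inner l) * δF j zero * δF k (inner l)
      + δF i zero * δF j (inner l) * δF k (inner l))

{-# OPTIONS --safe #-}
-- Fix w ≠ ε and weight x_g and y_g by rank g, and z_k by −rank k, where rank is 0 at ε,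
-- 2 at w and 1 elsewhere.  The term x_g y_h z_{gh} of T_G then has weight
-- rank g + rank h − rank (gh) ≥ 0, with equality exactly when g = ε, h = ε, or gh = w
-- (which forces g, h ∉ {ε, w}).  The surviving terms x_ε y_h z_h, x_g y_ε z_g and
-- x_g y_{g⁻¹w} z_w are those of CW^σ_{q−2} once the x- and y-variables are renamed by
-- ε ↦ 0, w ↦ q−1, the z-variables by ε ↦ q−1, w ↦ 0, and σ is induced by g ↦ g⁻¹w on
-- the other q−2 elements.  Both tensors are 0/1-valued with the same support, so they agree.
module Submission where

open import Defs
open import Algebra.Bundles using (Group)
open import Algebra.Structures using (IsGroup)
import Algebra.Properties.Group as GroupProperties
import Algebra.Properties.Loop as LoopProperties
import Algebra.Properties.Quasigroup as QuasigroupProperties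
open import Data.Bool using (if_then_else_)
open import Data.Empty using (⊥-elim)
open import Data.Fin using (Fin; zero; suc)
import Data.Fin as Fin
open import Data.Fin.Permutation as Perm using (Permutation′; _⟨$⟩ʳ_; _⟨$⟩ˡ_; permutation)
import Data.Fin.Permutation.Components as PC
open import Data.Fin.Properties using (suc-injective; inject₁-injective; fromℕ≢inject₁)
open import Data.Integer as ℤ using (+_; +≤+)
open import Data.Integer.Properties using (+-injective; i≡j⇒i-j≡0; i-j≡0⇒i≡j; i≤j⇒0≤j-i)
open import Data.Nat as ℕ using (ℕ; zero; suc; _+_; _*_; _∸_; _≤_; _<_; z≤n; s≤s)
open import Data.Nat.Properties
  using (*-zeroʳ; +-identityʳ; m∸n≤m; <⇒≤; <-irrefl; +-mono-≤; 0≢1+n; ≤-reflexive; ≤-trans)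
open import Data.Product using (Σ; ∃; _×_; _,_; proj₁; proj₂)
open import Data.Sum using (_⊎_; inj₁; inj₂)
open import Function.Base using (_∘_)
open import Function.Bundles using (_⤖_; _↔_; Inverse; Bijection; mk↔ₛ′)
open import Function.Construct.Composition using (_↔-∘_)
open import Function.Construct.Symmetry using (↔-sym)
open import Function.Properties.Bijection using (⤖⇒↔)
open import Function.Properties.Inverse using (↔⇒⤖)
open import Relation.Binary.Definitions using (DecidableEquality)
open import Relation.Binary.PropositionalEquality
open import Relation.Nullary using (yes; no)
open import Relation.Nullary.Decidable using (⌊_⌋)

module _ {A : Set} (_≟ᴬ_ : DecidableEquality A) where

  δ-refl : ∀ a → δ _≟ᴬ_ a a ≡ 1
  δ-refl a with a ≟ᴬ a
  ... | yes _  = refl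
  ... | no a≢a = ⊥-elim (a≢a refl)

  δ-≢ : ∀ {a b} → a ≢ b → δ _≟ᴬ_ a b ≡ 0
  δ-≢ {a} {b} a≢b with a ≟ᴬ b
  ... | yes a≡b = ⊥-elim (a≢b a≡b)
  ... | no _    = refl

  δ≢0⇒≡ : ∀ {a b} → δ _≟ᴬ_ a b ≢ 0 → a ≡ b
  δ≢0⇒≡ {a} {b} δ≢0 with a ≟ᴬ b
  ... | yes a≡b = a≡b
  ... | no _    = ⊥-elim (δ≢0 refl)

+≢0 : ∀ {m n} → m + n ≢ 0 → m ≢ 0 ⊎ n ≢ 0
+≢0 {zero}  n≢0 = inj₂ n≢0
+≢0 {suc m} _   = inj₁ λ ()

*≢0 : ∀ {m n} → m * n ≢ 0 → m ≢ 0 × n ≢ 0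
*≢0 {m} {n} mn≢0 = (λ m≡0 → mn≢0 (cong (_* n) m≡0))
                 , (λ n≡0 → mn≢0 (trans (cong (m *_) n≡0) (*-zeroʳ m)))

ΣFin-≢0 : ∀ n {f : Fin n → ℕ} → ΣFin n f ≢ 0 → ∃ λ l → f l ≢ 0
ΣFin-≢0 zero    Σ≢0 = ⊥-elim (Σ≢0 refl)
ΣFin-≢0 (suc n) Σ≢0 with +≢0 Σ≢0
... | inj₁ f0≢0 = zero , f0≢0
... | inj₂ Σ′≢0 with ΣFin-≢0 n Σ′≢0
...   | l , fl≢0 = suc l , fl≢0

ΣFin-zero : ∀ n {f : Fin n → ℕ} → (∀ l → f l ≡ 0) → ΣFin n f ≡ 0
ΣFin-zero zero    _    = refl
ΣFin-zero (suc n) f≡0 rewrite f≡0 zero = ΣFin-zero n (λ l → f≡0 (suc l))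

ΣFin-single : ∀ n {f : Fin n → ℕ} l → (∀ l′ → l′ ≢ l → f l′ ≡ 0) → ΣFin n f ≡ f l
ΣFin-single (suc n) zero f≡0
  rewrite ΣFin-zero n (λ l′ → f≡0 (suc l′) λ ()) = +-identityʳ _
ΣFin-single (suc n) (suc l) f≡0
  rewrite f≡0 zero (λ ()) =
    ΣFin-single n l (λ l′ l′≢l → f≡0 (suc l′) (l′≢l ∘ suc-injective))

indicator-unique : ∀ {P : Set} {m n : ℕ} →
                   (P → m ≡ 1) → (m ≢ 0 → P) → (P → n ≡ 1) → (n ≢ 0 → P) → m ≡ n
indicator-unique {m = m} {n} P⇒m≡1 m≢0⇒P P⇒n≡1 n≢0⇒P with m ℕ.≟ 0 | n ℕ.≟ 0
... | yes m≡0 | yes n≡0 = trans m≡0 (sym n≡0)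
... | yes m≡0 | no n≢0  = ⊥-elim (0≢1+n (trans (sym m≡0) (P⇒m≡1 (n≢0⇒P n≢0))))
... | no m≢0  | _       = trans (P⇒m≡1 p) (sym (P⇒n≡1 p))
  where p = m≢0⇒P m≢0

module _ {X Y Z : Set} (a : X → ℕ) (b : Y → ℕ) (c : Z → ℕ) where

  balancedPart : Tensor X Y Z → Tensor X Y Z
  balancedPart t i j k = if ⌊ a i + b j ℕ.≟ c k ⌋ then t i j k else 0

  module _ (t : Tensor X Y Z) {i : X} {j : Y} {k : Z} where

    balancedPart-≢0 : balancedPart t i j k ≢ 0 → a i + b j ≡ c k × t i j k ≢ 0
    balancedPart-≢0 ≢0 with a i + b j ℕ.≟ c k
    ... | yes balanced = balanced , ≢0
    ... | no _         = ⊥-elim (≢0 refl)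

    balancedPart-balanced : a i + b j ≡ c k → balancedPart t i j k ≡ t i j k
    balancedPart-balanced balanced with a i + b j ℕ.≟ c k
    ... | yes _          = refl
    ... | no unbalanced = ⊥-elim (unbalanced balanced)

  balancedPart-degeneration : (t : Tensor X Y Z) → (∀ i j k → t i j k ≢ 0 → c k ≤ a i + b j) →
                              MonomialDegeneration t (balancedPart t)
  balancedPart-degeneration t c≤a+b = record
    { a        = λ i → + a i
    ; b        = λ j → + b j
    ; c        = λ k → ℤ.- + c k
    ; deletion = deletion
    ; nonneg   = λ i j k ≢0 → i≤j⇒0≤j-i (+≤+ (c≤a+b i j k ≢0))
    ; keep     = λ i j k _ w≡0 → balancedPart-balanced t (+-injective (i-j≡0⇒i≡j _ _ w≡0))
    ; weight0  = λ i j k ≢0 → i≡j⇒i-j≡0 (cong +_ (proj₁ (balancedPart-≢0 t ≢0)))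
    }
    where
    deletion : ∀ i j k → balancedPart t i j k ≡ 0 ⊎ balancedPart t i j k ≡ t i j k
    deletion i j k with a i + b j ℕ.≟ c k
    ... | yes _ = inj₂ refl
    ... | no _  = inj₁ refl

data Position {m : ℕ} : Fin (suc (suc m)) → Set where
  at-zero  : Position zero
  at-top   : Position top
  at-inner : (l : Fin m) → Position (inner l)

position : ∀ {m} (i : Fin (suc (suc m))) → Position i
position zero = at-zero
position {zero} (suc zero) = at-top
position {suc m} (suc i) with position i
... | at-zero    = at-inner zero
... | at-top     = at-top
... | at-inner l = at-inner (suc l)

inner-injective : ∀ {m} {l l′ : Fin m} → inner l ≡ inner l′ → l ≡ l′
inner-injective = inject₁-injective ∘ suc-injective

zero≢inner : ∀ {m} {l : Fin m} → zero ≢ inner l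
zero≢inner ()

top≢inner : ∀ {m} {l : Fin m} → top ≢ inner l
top≢inner = fromℕ≢inject₁ ∘ suc-injective

inner-of : ∀ {m} (i : Fin (suc (suc m))) → i ≢ zero → i ≢ top → ∃ λ l → i ≡ inner l
inner-of i i≢zero i≢top with position i
... | at-zero    = ⊥-elim (i≢zero refl)
... | at-top     = ⊥-elim (i≢top refl)
... | at-inner l = l , refl

module _ {n : ℕ} where

  transpose-matchˡ : (i j : Fin n) → PC.transpose i j i ≡ j
  transpose-matchˡ i j with i Fin.≟ i
  ... | yes _  = refl
  ... | no i≢i = ⊥-elim (i≢i refl)

  transpose-matchʳ : (i j : Fin n) → PC.transpose i j j ≡ i
  transpose-matchʳ i j with j Fin.≟ i
  ... | yes j≡i = j≡i
  ... | no _ with j Fin.≟ j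
  ...   | yes _  = refl
  ...   | no j≢j = ⊥-elim (j≢j refl)

  transpose-mismatch : (i j : Fin n) {k : Fin n} → k ≢ i → k ≢ j → PC.transpose i j k ≡ k
  transpose-mismatch i j {k} k≢i k≢j with k Fin.≟ i
  ... | yes k≡i = ⊥-elim (k≢i k≡i)
  ... | no _ with k Fin.≟ j
  ...   | yes k≡j = ⊥-elim (k≢j k≡j)
  ...   | no _    = refl

module _ {m : ℕ} where

  swapEnds : Permutation′ (suc (suc m))
  swapEnds = Perm.transpose zero top

  swapEnds-top : swapEnds ⟨$⟩ʳ top ≡ zero
  swapEnds-top = transpose-matchʳ zero top

  swapEnds-inner : ∀ l → swapEnds ⟨$⟩ʳ inner l ≡ inner l
  swapEnds-inner l = transpose-mismatch zero top (λ ()) (top≢inner ∘ sym)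

  swapEnds⁻¹-top : swapEnds ⟨$⟩ˡ top ≡ zero
  swapEnds⁻¹-top = transpose-matchˡ top zero

  swapEnds⁻¹-inner : ∀ l → swapEnds ⟨$⟩ˡ inner l ≡ inner l
  swapEnds⁻¹-inner l = transpose-mismatch top zero (top≢inner ∘ sym) (λ ())

  endSwap-preserves-inner : (ρ : Permutation′ (suc (suc m))) →
                            ρ ⟨$⟩ʳ zero ≡ top → ρ ⟨$⟩ʳ top ≡ zero →
                            ∀ l → ∃ λ l′ → ρ ⟨$⟩ʳ inner l ≡ inner l′
  endSwap-preserves-inner ρ ρ0≡top ρtop≡0 l = inner-of (ρ ⟨$⟩ʳ inner l)
    (λ ≡zero → top≢inner (ρ-injective (trans ρtop≡0 (sym ≡zero))))
    (λ ≡top  → zero≢inner (ρ-injective (trans ρ0≡top (sym ≡top))))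
    where
    ρ-injective : ∀ {i j} → ρ ⟨$⟩ʳ i ≡ ρ ⟨$⟩ʳ j → i ≡ j
    ρ-injective eq = trans (sym (Perm.inverseˡ ρ)) (trans (cong (ρ ⟨$⟩ˡ_) eq) (Perm.inverseˡ ρ))

  -- Opaque: its normal form is huge and would otherwise be unfolded whenever a goal
  -- mentioning the restricted permutation is normalised.
  opaque
    restrictToInner : (π : Permutation′ (suc (suc m))) →
                      π ⟨$⟩ʳ zero ≡ top → π ⟨$⟩ʳ top ≡ zero →
                      Σ (Permutation′ m) λ σ → ∀ l → π ⟨$⟩ʳ inner l ≡ inner (σ ⟨$⟩ʳ l)
    restrictToInner π π0≡top πtop≡0 = σ , proj₂ ∘ forth
      where
      forth : ∀ l → ∃ λ l′ → π ⟨$⟩ʳ inner l ≡ inner l′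
      forth = endSwap-preserves-inner π π0≡top πtop≡0

      back : ∀ l → ∃ λ l′ → π ⟨$⟩ˡ inner l ≡ inner l′
      back = endSwap-preserves-inner (Perm.flip π)
                (trans (cong (π ⟨$⟩ˡ_) (sym πtop≡0)) (Perm.inverseˡ π))
                (trans (cong (π ⟨$⟩ˡ_) (sym π0≡top)) (Perm.inverseˡ π))
      open ≡-Reasoning

      σ : Permutation′ m
      σ = permutation (proj₁ ∘ forth) (proj₁ ∘ back)
        (λ l → inner-injective (begin
          inner (proj₁ (forth (proj₁ (back l))))  ≡⟨ proj₂ (forth _) ⟨
          π ⟨$⟩ʳ inner (proj₁ (back l))           ≡⟨ cong (π ⟨$⟩ʳ_) (proj₂ (back l)) ⟨
          π ⟨$⟩ʳ (π ⟨$⟩ˡ inner l)                 ≡⟨ Perm.inverseʳ π ⟩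
          inner l                                 ∎))
        (λ l → inner-injective (begin
          inner (proj₁ (back (proj₁ (forth l))))  ≡⟨ proj₂ (back _) ⟨
          π ⟨$⟩ˡ inner (proj₁ (forth l))          ≡⟨ cong (π ⟨$⟩ˡ_) (proj₂ (forth l)) ⟨
          π ⟨$⟩ˡ (π ⟨$⟩ʳ inner l)                 ≡⟨ Perm.inverseˡ π ⟩
          inner l                                 ∎))

δF-refl : ∀ {n} (i : Fin n) → δF i i ≡ 1
δF-refl = δ-refl Fin._≟_

δF-≢ : ∀ {n} {i j : Fin n} → i ≢ j → δF i j ≡ 0
δF-≢ = δ-≢ Fin._≟_

δF≢0⇒≡ : ∀ {n} {i j : Fin n} → δF i j ≢ 0 → i ≡ j
δF≢0⇒≡ = δ≢0⇒≡ Fin._≟_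

δF-inner-≢ : ∀ {m} {l l′ : Fin m} → l′ ≢ l → δF (inner l) (inner l′) ≡ 0
δF-inner-≢ l′≢l = δF-≢ (l′≢l ∘ sym ∘ inner-injective)

module _ {m : ℕ} (σ : Permutation′ m) where

  data CWTerm : Fin (suc (suc m)) → Fin (suc (suc m)) → Fin (suc (suc m)) → Set where
    z-top    : CWTerm zero zero top
    y-top    : CWTerm zero top zero
    x-top    : CWTerm top zero zero
    xy-inner : ∀ l → CWTerm (inner l) (inner (σ ⟨$⟩ʳ l)) zero
    xz-inner : ∀ l → CWTerm (inner l) zero (inner l)
    yz-inner : ∀ l → CWTerm zero (inner l) (inner l)

  CWTerm-≡ : ∀ {i j k i′ j′ k′} → i ≡ i′ → j ≡ j′ → k ≡ k′ →
             CWTerm i′ j′ k′ → CWTerm i j k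
  CWTerm-≡ refl refl refl t = t

  CWTerm-left : ∀ i → CWTerm zero i (swapEnds ⟨$⟩ʳ i)
  CWTerm-left i with position i
  ... | at-zero    = z-top
  ... | at-top     rewrite swapEnds-top {m} = y-top
  ... | at-inner l rewrite swapEnds-inner l = yz-inner l

  CWTerm-right : ∀ i → CWTerm i zero (swapEnds ⟨$⟩ʳ i)
  CWTerm-right i with position i
  ... | at-zero    = z-top
  ... | at-top     rewrite swapEnds-top {m} = x-top
  ... | at-inner l rewrite swapEnds-inner l = xz-inner l

  monomial : (i j k a b c : Fin (suc (suc m))) → ℕ
  monomial i j k a b c = δF i a * δF j b * δF k c

  monomial≢0 : ∀ {i j k a b c} → CWTerm a b c → monomial i j k a b c ≢ 0 → CWTerm i j k
  monomial≢0 {i} {j} {k} {a} {b} {c} t ≢0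
    with *≢0 {δF i a * δF j b} {δF k c} ≢0
  ... | ij≢0 , k≢0 with *≢0 {δF i a} {δF j b} ij≢0
  ...   | i≢0 , j≢0 = CWTerm-≡ (δF≢0⇒≡ i≢0) (δF≢0⇒≡ j≢0) (δF≢0⇒≡ k≢0) t

  innerMonomials : (i j k : Fin (suc (suc m))) → Fin m → ℕ
  innerMonomials i j k l = monomial i j k (inner l) (inner (σ ⟨$⟩ʳ l)) zero
                         + monomial i j k (inner l) zero (inner l)
                         + monomial i j k zero (inner l) (inner l)

  CW-support : ∀ {i j k} → CW m σ i j k ≢ 0 → CWTerm i j k
  CW-support {i} {j} {k} ≢0
    with +≢0 {monomial i j k zero zero top + monomial i j k zero top zero
              + monomial i j k top zero zero} ≢0
  ... | inj₁ outer≢0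
    with +≢0 {monomial i j k zero zero top + monomial i j k zero top zero} outer≢0
  ...   | inj₂ x≢0 = monomial≢0 x-top x≢0
  ...   | inj₁ zy≢0 with +≢0 {monomial i j k zero zero top} zy≢0
  ...     | inj₁ z≢0 = monomial≢0 z-top z≢0
  ...     | inj₂ y≢0 = monomial≢0 y-top y≢0
  CW-support {i} {j} {k} ≢0 | inj₂ Σ≢0 with ΣFin-≢0 m Σ≢0
  ... | l , l≢0
    with +≢0 {monomial i j k (inner l) (inner (σ ⟨$⟩ʳ l)) zero
              + monomial i j k (inner l) zero (inner l)} l≢0
  ...   | inj₂ yz≢0 = monomial≢0 (yz-inner l) yz≢0
  ...   | inj₁ xyxz≢0 with +≢0 {monomial i j k (inner l) (inner (σ ⟨$⟩ʳ l)) zero} xyxz≢0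
  ...     | inj₁ xy≢0 = monomial≢0 (xy-inner l) xy≢0
  ...     | inj₂ xz≢0 = monomial≢0 (xz-inner l) xz≢0

  innerMonomials-x : ∀ {l} j k l′ → l′ ≢ l → innerMonomials (inner l) j k l′ ≡ 0
  innerMonomials-x j k l′ l′≢l rewrite δF-inner-≢ l′≢l = refl

  innerMonomials-y : ∀ {l} k l′ → l′ ≢ l → innerMonomials zero (inner l) k l′ ≡ 0
  innerMonomials-y k l′ l′≢l rewrite δF-inner-≢ l′≢l = refl

  CW-term : ∀ {i j k} → CWTerm i j k → CW m σ i j k ≡ 1
  CW-term z-top rewrite δF-refl (top {m}) = cong suc (ΣFin-zero m λ _ → refl)
  CW-term y-top rewrite δF-refl (top {m}) = cong suc (ΣFin-zero m λ l → *-zeroʳ (1 * δF top (inner l)))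
  CW-term x-top rewrite δF-refl (top {m}) = cong suc (ΣFin-zero m vanish)
    where
    vanish : ∀ l → innerMonomials top zero zero l ≡ 0
    vanish l rewrite δF-≢ (top≢inner {l = l}) = refl
  CW-term (xy-inner l)
    rewrite δF-≢ {i = inner l} (top≢inner ∘ sym)
          | ΣFin-single m l (innerMonomials-x (inner (σ ⟨$⟩ʳ l)) zero)
          | δF-refl (inner l) | δF-refl (inner (σ ⟨$⟩ʳ l)) = refl
  CW-term (xz-inner l)
    rewrite δF-≢ {i = inner l} (top≢inner ∘ sym)
          | ΣFin-single m l (innerMonomials-x zero (inner l))
          | δF-refl (inner l) = refl
  CW-term (yz-inner l)
    rewrite δF-≢ {i = inner l} (top≢inner ∘ sym)
          | ΣFin-single m l (innerMonomials-y (inner l))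
          | δF-refl (inner l) = refl

moveToZero : ∀ {A : Set} {n} (e : A ↔ Fin (suc n)) (a : A) →
             Σ (A ↔ Fin (suc n)) λ α → Inverse.to α a ≡ zero
moveToZero e a = Perm.transpose (Inverse.to e a) zero ↔-∘ e , transpose-matchˡ (Inverse.to e a) zero

HasCWDegeneration : FiniteGroup → ℕ → Set
HasCWDegeneration G m =
  Σ (Tensor Carrier Carrier Carrier) λ t →
    MonomialDegeneration (T G) t ×
    Σ (Permutation′ m) λ σ →
    Σ (Carrier ⤖ Fin (suc (suc m))) λ α →
    Σ (Carrier ⤖ Fin (suc (suc m))) λ β →
    Σ (Carrier ⤖ Fin (suc (suc m))) λ γ →
      ∀ g h k → t g h k ≡ CW m σ (Bijection.to α g) (Bijection.to β h) (Bijection.to γ k)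
  where open FiniteGroup G using (Carrier)

module _ (G : FiniteGroup) {m : ℕ} (enum : FiniteGroup.Carrier G ↔ Fin (suc (suc m))) where

  open FiniteGroup G using (Carrier; _∙_; ε; isGroup; _≟_)
  open IsGroup isGroup using (identityˡ; identityʳ; _\\_; _//_)

  private
    group : Group _ _
    group = record { isGroup = isGroup }

  open GroupProperties group using (\\-leftDividesˡ; //-rightDividesˡ; loop; quasigroup)
  open LoopProperties loop using (ε\\x≈x; x\\x≈ε; identityˡ-unique; identityʳ-unique)
  open QuasigroupProperties quasigroup using (y≈x\\z; x≈z//y)

  α : Carrier ↔ Fin (suc (suc m))
  α = proj₁ (moveToZero enum ε)

  private
    module α = Inverse α

  α-ε : α.to ε ≡ zero
  α-ε = proj₂ (moveToZero enum ε)

  α-injective : ∀ {g h} → α.to g ≡ α.to h → g ≡ h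
  α-injective {g} {h} eq = trans (sym (α.strictlyInverseʳ g)) (trans (cong α.from eq) (α.strictlyInverseʳ h))

  α⁻¹-zero : α.from zero ≡ ε
  α⁻¹-zero = trans (cong α.from (sym α-ε)) (α.strictlyInverseʳ ε)

  w : Carrier
  w = α.from top

  α-w : α.to w ≡ top
  α-w = α.strictlyInverseˡ top

  w≢ε : w ≢ ε
  w≢ε w≡ε = zero≢top (trans (sym α-ε) (trans (cong α.to (sym w≡ε)) α-w))
    where
    zero≢top : zero ≢ top {m}
    zero≢top ()

  α⁻¹-inner-≢ε : ∀ l → α.from (inner l) ≢ ε
  α⁻¹-inner-≢ε l eq =
    zero≢inner (trans (sym α-ε) (trans (cong α.to (sym eq)) (α.strictlyInverseˡ (inner l))))

  α⁻¹-inner-≢w : ∀ l → α.from (inner l) ≢ w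
  α⁻¹-inner-≢w l eq =
    top≢inner (trans (sym α-w) (trans (cong α.to (sym eq)) (α.strictlyInverseˡ (inner l))))

  complement : Carrier ↔ Carrier
  complement = mk↔ₛ′ (_\\ w) (w //_)
    (λ k → sym (y≈x\\z (w // k) k w (//-rightDividesˡ k w)))
    (λ g → sym (x≈z//y g (g \\ w) w (\\-leftDividesˡ g w)))

  complement-≢ε : ∀ {g} → g ≢ w → g \\ w ≢ ε
  complement-≢ε {g} g≢w eq =
    g≢w (trans (sym (identityʳ g)) (trans (cong (g ∙_) (sym eq)) (\\-leftDividesˡ g w)))

  complement-≢w : ∀ {g} → g ≢ ε → g \\ w ≢ w
  complement-≢w {g} g≢ε eq =
    g≢ε (identityˡ-unique g w (trans (cong (g ∙_) (sym eq)) (\\-leftDividesˡ g w)))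

  π : Permutation′ (suc (suc m))
  π = α ↔-∘ (complement ↔-∘ ↔-sym α)

  π-zero : π ⟨$⟩ʳ zero ≡ top
  π-zero rewrite α⁻¹-zero | ε\\x≈x w = α-w

  π-top : π ⟨$⟩ʳ top ≡ zero
  π-top rewrite x\\x≈ε w = α-ε

  σ : Permutation′ m
  σ = proj₁ (restrictToInner π π-zero π-top)

  σ-spec : ∀ l → α.to (α.from (inner l) \\ w) ≡ inner (σ ⟨$⟩ʳ l)
  σ-spec = proj₂ (restrictToInner π π-zero π-top)

  -- Opaque so that the case splits on _≟_ below do not abstract inside it.
  opaque
    rank : Carrier → ℕ
    rank x = (1 ∸ δ _≟_ x ε) + δ _≟_ x w

    rank-ε : rank ε ≡ 0
    rank-ε rewrite δ-refl _≟_ ε | δ-≢ _≟_ (w≢ε ∘ sym) = refl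

    rank-w : rank w ≡ 2
    rank-w rewrite δ-≢ _≟_ w≢ε | δ-refl _≟_ w = refl

    rank-other : ∀ {x} → x ≢ ε → x ≢ w → rank x ≡ 1
    rank-other x≢ε x≢w rewrite δ-≢ _≟_ x≢ε | δ-≢ _≟_ x≢w = refl

    1≤rank : ∀ {x} → x ≢ ε → 1 ≤ rank x
    1≤rank x≢ε rewrite δ-≢ _≟_ x≢ε = s≤s z≤n

    rank≤1 : ∀ {x} → x ≢ w → rank x ≤ 1
    rank≤1 {x} x≢w rewrite δ-≢ _≟_ x≢w | +-identityʳ (1 ∸ δ _≟_ x ε) = m∸n≤m 1 (δ _≟_ x ε)

  rank-unbalanced : ∀ {g h k} → g ≢ ε → h ≢ ε → k ≢ w → rank k < rank g + rank h
  rank-unbalanced g≢ε h≢ε k≢w =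
    ≤-trans (s≤s (rank≤1 k≢w)) (+-mono-≤ (1≤rank g≢ε) (1≤rank h≢ε))

  data Surviving : Carrier → Carrier → Carrier → Set where
    left-unit  : ∀ h → Surviving ε h h
    right-unit : ∀ g → Surviving g ε g
    complementary : ∀ {g} → g ≢ ε → g ≢ w → Surviving g (g \\ w) w

  Surviving-≡ : ∀ {g h k g′ h′ k′} → g ≡ g′ → h ≡ h′ → k ≡ k′ →
                Surviving g′ h′ k′ → Surviving g h k
  Surviving-≡ refl refl refl s = s

  surviving-product : ∀ {g h k} → Surviving g h k → k ≡ g ∙ h
  surviving-product (left-unit h)              = sym (identityˡ h)
  surviving-product (right-unit g)             = sym (identityʳ g)
  surviving-product (complementary {g} _ _) = sym (\\-leftDividesˡ g w)

  surviving-balanced : ∀ {g h k} → Surviving g h k → rank g + rank h ≡ rank k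
  surviving-balanced (left-unit h) rewrite rank-ε = refl
  surviving-balanced (right-unit g) rewrite rank-ε = +-identityʳ (rank g)
  surviving-balanced (complementary g≢ε g≢w)
    rewrite rank-other g≢ε g≢w | rank-other (complement-≢ε g≢w) (complement-≢w g≢ε) | rank-w = refl

  surviving-or-unbalanced : ∀ {g h k} → k ≡ g ∙ h → Surviving g h k ⊎ rank k < rank g + rank h
  surviving-or-unbalanced {g} {h} refl with g ≟ ε | h ≟ ε | (g ∙ h) ≟ w
  ... | yes refl | _        | _        = inj₁ (Surviving-≡ refl refl (identityˡ h) (left-unit h))
  ... | no _     | yes refl | _        = inj₁ (Surviving-≡ refl refl (identityʳ g) (right-unit g))
  ... | no g≢ε   | no h≢ε   | yes gh≡w =
    inj₁ (Surviving-≡ refl (y≈x\\z g h w gh≡w) gh≡w (complementary g≢ε g≢w))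
    where
    g≢w : g ≢ w
    g≢w refl = h≢ε (identityʳ-unique w h gh≡w)
  ... | no g≢ε   | no h≢ε   | no gh≢w  = inj₂ (rank-unbalanced g≢ε h≢ε gh≢w)

  T-product : ∀ {g h k} → k ≡ g ∙ h → T G g h k ≡ 1
  T-product refl = δ-refl _≟_ _

  T-nonneg : ∀ g h k → T G g h k ≢ 0 → rank k ≤ rank g + rank h
  T-nonneg g h k T≢0 with surviving-or-unbalanced (δ≢0⇒≡ _≟_ T≢0)
  ... | inj₁ surviving  = ≤-reflexive (sym (surviving-balanced surviving))
  ... | inj₂ unbalanced = <⇒≤ unbalanced

  balancedT : Tensor Carrier Carrier Carrier
  balancedT = balancedPart rank rank rank (T G)

  balancedT-surviving : ∀ {g h k} → Surviving g h k → balancedT g h k ≡ 1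
  balancedT-surviving s =
    trans (balancedPart-balanced rank rank rank (T G) (surviving-balanced s))
          (T-product (surviving-product s))

  balancedT-support : ∀ {g h k} → balancedT g h k ≢ 0 → Surviving g h k
  balancedT-support ≢0 with balancedPart-≢0 rank rank rank (T G) ≢0
  ... | balanced , T≢0 with surviving-or-unbalanced (δ≢0⇒≡ _≟_ T≢0)
  ...   | inj₁ surviving  = surviving
  ...   | inj₂ unbalanced = ⊥-elim (<-irrefl (sym balanced) unbalanced)

  γ : Carrier ↔ Fin (suc (suc m))
  γ = swapEnds ↔-∘ α

  private
    module γ = Inverse γ

  γ-w : γ.to w ≡ zero
  γ-w = trans (cong (swapEnds ⟨$⟩ʳ_) α-w) (swapEnds-top {m})

  CWTerm-surviving : ∀ {g h k} → Surviving g h k → CWTerm σ (α.to g) (α.to h) (γ.to k)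
  CWTerm-surviving (left-unit h)  = CWTerm-≡ σ α-ε refl refl (CWTerm-left σ (α.to h))
  CWTerm-surviving (right-unit g) = CWTerm-≡ σ refl α-ε refl (CWTerm-right σ (α.to g))
  CWTerm-surviving (complementary {g} g≢ε g≢w)
    with inner-of (α.to g) (λ αg≡zero → g≢ε (α-injective (trans αg≡zero (sym α-ε))))
                           (λ αg≡top  → g≢w (α-injective (trans αg≡top (sym α-w))))
  ... | l , αg≡l = CWTerm-≡ σ αg≡l α-complement γ-w (xy-inner l)
    where
    α-complement : α.to (g \\ w) ≡ inner (σ ⟨$⟩ʳ l)
    α-complement = begin
      α.to (g \\ w)                  ≡⟨ cong (λ x → α.to (x \\ w)) (α.strictlyInverseʳ g) ⟨
      α.to (α.from (α.to g) \\ w)    ≡⟨ cong (λ i → α.to (α.from i \\ w)) αg≡l ⟩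
      α.to (α.from (inner l) \\ w)   ≡⟨ σ-spec l ⟩
      inner (σ ⟨$⟩ʳ l)                ∎
      where open ≡-Reasoning

  γ⁻¹-top : γ.from top ≡ ε
  γ⁻¹-top = trans (cong α.from (swapEnds⁻¹-top {m})) α⁻¹-zero

  γ⁻¹-inner : ∀ l → γ.from (inner l) ≡ α.from (inner l)
  γ⁻¹-inner l = cong α.from (swapEnds⁻¹-inner l)

  surviving-CWTerm : ∀ {i j k} → CWTerm σ i j k → Surviving (α.from i) (α.from j) (γ.from k)
  surviving-CWTerm z-top        = Surviving-≡ α⁻¹-zero α⁻¹-zero γ⁻¹-top (left-unit ε)
  surviving-CWTerm y-top        = Surviving-≡ α⁻¹-zero refl refl (left-unit w)
  surviving-CWTerm x-top        = Surviving-≡ refl α⁻¹-zero refl (right-unit w)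
  surviving-CWTerm (xy-inner l) =
    Surviving-≡ refl (trans (cong α.from (sym (σ-spec l))) (α.strictlyInverseʳ _)) refl
      (complementary (α⁻¹-inner-≢ε l) (α⁻¹-inner-≢w l))
  surviving-CWTerm (xz-inner l) = Surviving-≡ refl α⁻¹-zero (γ⁻¹-inner l) (right-unit _)
  surviving-CWTerm (yz-inner l) = Surviving-≡ α⁻¹-zero refl (γ⁻¹-inner l) (left-unit _)

  pulledCW : Tensor Carrier Carrier Carrier
  pulledCW g h k = CW m σ (α.to g) (α.to h) (γ.to k)

  pulledCW-support : ∀ {g h k} → pulledCW g h k ≢ 0 → Surviving g h k
  pulledCW-support {g} {h} {k} ≢0 =
    Surviving-≡ (sym (α.strictlyInverseʳ g)) (sym (α.strictlyInverseʳ h)) (sym (γ.strictlyInverseʳ k))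
      (surviving-CWTerm (CW-support σ {α.to g} {α.to h} {γ.to k} ≢0))

  balancedT≗pulledCW : ∀ g h k → balancedT g h k ≡ pulledCW g h k
  balancedT≗pulledCW g h k = indicator-unique {P = Surviving g h k}
    balancedT-surviving balancedT-support (CW-term σ ∘ CWTerm-surviving) pulledCW-support

  hasCWDegeneration : HasCWDegeneration G m
  hasCWDegeneration =
    balancedT , balancedPart-degeneration rank rank rank (T G) T-nonneg ,
    σ , ↔⇒⤖ α , ↔⇒⤖ α , ↔⇒⤖ γ , balancedT≗pulledCW

theorem7p4 : (G : FiniteGroup) → 2 ≤ FiniteGroup.order G →
  Σ (Tensor (FiniteGroup.Carrier G) (FiniteGroup.Carrier G) (FiniteGroup.Carrier G)) λ t →
    MonomialDegeneration (T G) t ×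
    Σ (Permutation′ (FiniteGroup.order G ∸ 2)) λ σ →
    Σ (FiniteGroup.Carrier G ⤖ Fin (suc (suc (FiniteGroup.order G ∸ 2)))) λ α →
    Σ (FiniteGroup.Carrier G ⤖ Fin (suc (suc (FiniteGroup.order G ∸ 2)))) λ β →
    Σ (FiniteGroup.Carrier G ⤖ Fin (suc (suc (FiniteGroup.order G ∸ 2)))) λ γ →
      ∀ g h k → t g h k ≡ CW (FiniteGroup.order G ∸ 2) σ
                            (Bijection.to α g) (Bijection.to β h) (Bijection.to γ k)
theorem7p4 G 2≤order = fromEnumeration (FiniteGroup.order G) 2≤order (FiniteGroup.enum G)
  where
  fromEnumeration : ∀ n → 2 ≤ n → Fin n ⤖ FiniteGroup.Carrier G → HasCWDegeneration G (n ∸ 2)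
  fromEnumeration (suc (suc m)) _ enum = hasCWDegeneration G (↔-sym (⤖⇒↔ enum))
  fromEnumeration (suc zero) (s≤s ()) _
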